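{- Let $n\ge 1$ and $d\ge 1$ be integers, let the symmetric group $S_d$ act on $(\mathbb{Z}/n\mathbb{Z})^d$ by permuting coordinates, and let $X=S_d\vec{x}$ be an orbit of this action. Define $\sigma_X:(\mathbb{Z}/n\mathbb{Z})^d\to\mathbb{C}$ by $\sigma_X(\vec{y})=\sum_{\vec{x}'\in X} e\!\left(\frac{\vec{x}'\cdot\vec{y}}{n}\right)$. Let $[X]=x_1+x_2+\cdots+x_d \pmod n$ for any representative $\vec{x}=(x_1,\dots,x_d)$ of $X$. Then the image $\sigma_X\big((\mathbb{Z}/n\mathbb{Z})^d\big)\subseteq\mathbb{C}$ has $\frac{n}{(n,[X])}$-fold dihedral symmetry.
   Context: $e(t)=\exp(2\pi i t)$; for $\vec{x},\vec{y}\in(\mathbb{Z}/n\mathbb{Z})^d$, $\vec{x}\cdot\vec{y}=\sum_{i=1}^d x_iy_i$ (computed mod $n$, which is harmless since $e$ has period $1$). $[X]$ does not depend on the choice of representative. $(n,a)$ denotes the greatest common divisor of $n$ and (any integer representative of) $a$, with $(n,0)=n$. A subset of $\mathbb{C}$ has $k$-fold dihedral symmetry if it is invariant under the dihedral group of order $2k$ generated by rotation about the origin through angle $2\pi/k$ and complex conjugation (reflection in the real axis). -}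

module Defs where

open import Level using (Level)
open import Data.Nat using (ℕ; zero; suc)
import Data.Nat as ℕ
open import Data.Nat.GCD using (gcd)
open import Data.Fin using (Fin; toℕ)
open import Data.Fin.Permutation using (Permutation′; _⟨$⟩ʳ_)
open import Data.List using (List; []; _∷_; map; concatMap; foldr; allFin)
open import Data.Product using (∃)
open import Data.Bool using (if_then_else_)
open import Relation.Nullary using (Dec; does)
open import Relation.Binary.PropositionalEquality using (_≡_)
open import Algebra.Bundles using (CommutativeRing)

-- Elements of (ℤ/nℤ)^d, with ℤ/nℤ represented by Fin n (residues 0..n-1).
Vecₙ : ℕ → ℕ → Set
Vecₙ n d = Fin d → Fin n

allVecs : (n d : ℕ) → List (Vecₙ n d)
allVecs n zero    = (λ ()) ∷ []
allVecs n (suc d) =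
  concatMap (λ a → map (λ f → λ { Fin.zero → a ; (Fin.suc i) → f i }) (allVecs n d)) (allFin n)

-- x · y (as a natural number; only its residue mod n matters below since ζ ^ n ≈ 1)
dot : {n d : ℕ} → Vecₙ n d → Vecₙ n d → ℕ
dot {d = d} x y = foldr ℕ._+_ 0 (map (λ i → toℕ (x i) ℕ.* toℕ (y i)) (allFin d))

-- [X] = x₁ + ⋯ + x_d (as a natural number; reduced mod n implicitly by gcd)
coordSum : {n d : ℕ} → Vecₙ n d → ℕ
coordSum {d = d} x = foldr ℕ._+_ 0 (map (λ i → toℕ (x i)) (allFin d))

InOrbit : {n d : ℕ} → Vecₙ n d → Vecₙ n d → Set
InOrbit {d = d} x z = ∃ λ (π : Permutation′ d) → ∀ i → z i ≡ x (π ⟨$⟩ʳ i)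

module _ {c ℓ : Level} (R : CommutativeRing c ℓ) where
  open CommutativeRing R

  pow : Carrier → ℕ → Carrier
  pow a zero    = 1#
  pow a (suc k) = a * pow a k

  ringSum : List Carrier → Carrier
  ringSum = foldr _+_ 0#

  -- σ_X(y) = Σ_{x' ∈ X} ζ^(x'·y), where X = S_d x; the sum ranges over all z in
  -- (ℤ/nℤ)^d with z ∈ X (decided by `dec`, whose choice does not affect the value).
  σ : {n d : ℕ} (ζ : Carrier) (x : Vecₙ n d) (dec : ∀ z → Dec (InOrbit x z))
      → Vecₙ n d → Carrier
  σ {n} {d} ζ x dec y =
    ringSum (map (λ z → if does (dec z) then pow ζ (dot z y) else 0#) (allVecs n d))

{-# OPTIONS --safe #-}
-- All points of an orbit X have the same coordinate sum [X], so translating y by k·(1,…,1)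
-- multiplies every term ζ^(x′·y) of σ_X(y) by the same factor ζ^(k[X]); by Bézout some k has
-- k[X] ≡ (n,[X]) mod n, which gives the rotation. Replacing y by −y, realised as (n−1)·y,
-- conjugates every term because conj ζ = ζ^(n−1), which gives the reflection.
module Submission where

open import Defs
open import Level using (Level)
open import Data.Nat as ℕ using (ℕ; zero; suc; NonZero; _≤_; _∸_; _%_; _/_)
open import Data.Nat.Properties as ℕ using ()
open import Data.Nat.DivMod using (m≡m%n+[m/n]*n)
open import Data.Nat.GCD using (gcd)
open import Data.List using (List; []; _∷_; map)
open import Data.Bool using (if_then_else_)
open import Data.Product using (∃; _×_; _,_)
open import Relation.Nullary using (Dec; yes; no; does)
open import Relation.Binary.PropositionalEquality as ≡ using (_≡_)
open import Algebra.Bundles using (CommutativeRing)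

module ModularArithmetic where

  open import Data.Nat using (_+_; _*_)
  open import Data.Nat.Properties using (+-*-semiring)
  open import Data.Nat.DivMod using (m%n<n; m%n%n≡m%n; %-distribˡ-+; %-distribˡ-*; [m+kn]%n≡m%n)
  open import Data.Nat.GCD using (gcd-GCD; module Bézout)
  open import Data.Nat.Solver using (module +-*-Solver)
  open import Data.Fin using (Fin; toℕ; fromℕ<)
  open import Data.Fin.Properties using (toℕ-fromℕ<)
  open import Data.Fin.Permutation using (_⟨$⟩ʳ_)
  open import Data.List using (foldr; allFin; tabulate)
  open import Data.List.Properties using (map-tabulate)
  open import Algebra.Properties.Semiring.Sum +-*-semiring
    using (sum-cong-≗; sum-permute; ∑-distrib-+; *-distribˡ-sum)
    renaming (sum to ∑)
  open ≡ using (refl; cong; cong₂; trans)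
  open ≡.≡-Reasoning

  listSum-allFin : ∀ d (f : Fin d → ℕ) → foldr _+_ 0 (map f (allFin d)) ≡ ∑ f
  listSum-allFin d f = trans (cong (foldr _+_ 0) (map-tabulate (λ i → i) f)) (sum-tabulate d f)
    where
    sum-tabulate : ∀ d (f : Fin d → ℕ) → foldr _+_ 0 (tabulate f) ≡ ∑ f
    sum-tabulate zero    f = refl
    sum-tabulate (suc d) f = cong (f Fin.zero +_) (sum-tabulate d (λ i → f (Fin.suc i)))

  coordSum-orbit : ∀ {n d} {x z : Vecₙ n d} → InOrbit x z → coordSum z ≡ coordSum x
  coordSum-orbit {d = d} {x} {z} (π , z≡x∘π) = begin
    coordSum z                  ≡⟨ listSum-allFin d (λ i → toℕ (z i)) ⟩
    ∑ (λ i → toℕ (z i))         ≡⟨ sum-cong-≗ (λ i → cong toℕ (z≡x∘π i)) ⟩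
    ∑ (λ i → toℕ (x (π ⟨$⟩ʳ i))) ≡⟨ sum-permute (λ i → toℕ (x i)) π ⟨
    ∑ (λ i → toℕ (x i))         ≡⟨ listSum-allFin d (λ i → toℕ (x i)) ⟨
    coordSum x                  ∎

  module _ {n : ℕ} .{{_ : NonZero n}} where

    +-cong-mod : ∀ {a b c e} → a % n ≡ b % n → c % n ≡ e % n → (a + c) % n ≡ (b + e) % n
    +-cong-mod {a} {b} {c} {e} a≡b c≡e = begin
      (a + c) % n             ≡⟨ %-distribˡ-+ a c n ⟩
      (a % n + c % n) % n     ≡⟨ cong₂ (λ u v → (u + v) % n) a≡b c≡e ⟩
      (b % n + e % n) % n     ≡⟨ %-distribˡ-+ b e n ⟨
      (b + e) % n             ∎

    *-congˡ-mod : ∀ a {b c} → b % n ≡ c % n → (a * b) % n ≡ (a * c) % n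
    *-congˡ-mod a {b} {c} b≡c = begin
      (a * b) % n             ≡⟨ %-distribˡ-* a b n ⟩
      (a % n * (b % n)) % n   ≡⟨ cong (λ u → (a % n * u) % n) b≡c ⟩
      (a % n * (c % n)) % n   ≡⟨ %-distribˡ-* a c n ⟨
      (a * c) % n             ∎

    ∑-cong-mod : ∀ {d} {f g : Fin d → ℕ} → (∀ i → f i % n ≡ g i % n) → ∑ f % n ≡ ∑ g % n
    ∑-cong-mod {zero}  f≡g = refl
    ∑-cong-mod {suc d} f≡g = +-cong-mod (f≡g Fin.zero) (∑-cong-mod (λ i → f≡g (Fin.suc i)))

    affine : ∀ {d} → ℕ → ℕ → Vecₙ n d → Vecₙ n d
    affine a b y i = fromℕ< (m%n<n (a * toℕ (y i) + b) n)

    dot-affine : ∀ {d} a b (z y : Vecₙ n d) →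
                 dot z (affine a b y) % n ≡ (a * dot z y + b * coordSum z) % n
    dot-affine {d} a b z y = begin
      dot z (affine a b y) % n
        ≡⟨ cong (_% n) (listSum-allFin d _) ⟩
      ∑ (λ i → zᵢ i * toℕ (affine a b y i)) % n
        ≡⟨ ∑-cong-mod (λ i → *-congˡ-mod (zᵢ i) (affine-residue i)) ⟩
      ∑ (λ i → zᵢ i * (a * yᵢ i + b)) % n
        ≡⟨ cong (_% n) (sum-cong-≗ (λ i → expand (zᵢ i) (yᵢ i))) ⟩
      ∑ (λ i → a * (zᵢ i * yᵢ i) + b * zᵢ i) % n
        ≡⟨ cong (_% n) (∑-distrib-+ (λ i → a * (zᵢ i * yᵢ i)) (λ i → b * zᵢ i)) ⟩
      (∑ (λ i → a * (zᵢ i * yᵢ i)) + ∑ (λ i → b * zᵢ i)) % n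
        ≡⟨ cong₂ (λ u v → (u + v) % n)
                 (*-distribˡ-sum a (λ i → zᵢ i * yᵢ i)) (*-distribˡ-sum b zᵢ) ⟨
      (a * ∑ (λ i → zᵢ i * yᵢ i) + b * ∑ zᵢ) % n
        ≡⟨ cong₂ (λ u v → (a * u + b * v) % n) (listSum-allFin d _) (listSum-allFin d _) ⟨
      (a * dot z y + b * coordSum z) % n ∎
      where
      zᵢ yᵢ : Fin d → ℕ
      zᵢ i = toℕ (z i)
      yᵢ i = toℕ (y i)
      affine-residue : ∀ i → toℕ (affine a b y i) % n ≡ (a * yᵢ i + b) % n
      affine-residue i = trans (cong (_% n) (toℕ-fromℕ< _)) (m%n%n≡m%n (a * yᵢ i + b) n)
      expand : ∀ u v → u * (a * v + b) ≡ a * (u * v) + b * u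
      expand u v = solve 4 (λ u v a b → u :* (a :* v :+ b) := a :* (u :* v) :+ b :* u) refl u v a b
        where open +-*-Solver

  bezout-mod : ∀ n m .{{_ : NonZero n}} → ∃ λ k → (k * m) % n ≡ gcd n m % n
  bezout-mod n@(suc n′) m with Bézout.identity (gcd-GCD n m)
  ... | Bézout.-+ x y g+xn≡ym = y , (begin
    (y * m) % n         ≡⟨ cong (_% n) g+xn≡ym ⟨
    (gcd n m + x * n) % n ≡⟨ [m+kn]%n≡m%n (gcd n m) x n ⟩
    gcd n m % n         ∎)
  -- Here y·m ≡ −gcd n m, and multiplying by n′ ≡ −1 flips the sign.
  ... | Bézout.+- x y g+ym≡xn = y * n′ , (begin
    (y * n′ * m) % n                 ≡⟨ [m+kn]%n≡m%n (y * n′ * m) x n ⟨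
    (y * n′ * m + x * n) % n         ≡⟨ cong (λ u → (y * n′ * m + u) % n) g+ym≡xn ⟨
    (y * n′ * m + (gcd n m + y * m)) % n ≡⟨ cong (_% n) (regroup y n′ m (gcd n m)) ⟩
    (gcd n m + y * m * n) % n        ≡⟨ [m+kn]%n≡m%n (gcd n m) (y * m) n ⟩
    gcd n m % n                      ∎)
    where
    regroup : ∀ y n′ m g → y * n′ * m + (g + y * m) ≡ g + y * m * suc n′
    regroup = solve 4 (λ y n′ m g →
      y :* n′ :* m :+ (g :+ y :* m) := g :+ y :* m :* (con 1 :+ n′)) refl
      where open +-*-Solver

open ModularArithmetic

module _ {c ℓ : Level} (R : CommutativeRing c ℓ) where
  open CommutativeRing R
  open import Relation.Binary.Reasoning.Setoid setoid

  pow-+ : ∀ a m k → pow R a (m ℕ.+ k) ≈ pow R a m * pow R a k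
  pow-+ a zero    k = sym (*-identityˡ _)
  pow-+ a (suc m) k = trans (*-congˡ (pow-+ a m k)) (sym (*-assoc _ _ _))

  pow-congˡ : ∀ {a b} k → a ≈ b → pow R a k ≈ pow R b k
  pow-congˡ zero    a≈b = refl
  pow-congˡ (suc k) a≈b = *-cong a≈b (pow-congˡ k a≈b)

  pow-* : ∀ a m k → pow R (pow R a m) k ≈ pow R a (k ℕ.* m)
  pow-* a m zero    = refl
  pow-* a m (suc k) = trans (*-congˡ (pow-* a m k)) (sym (pow-+ a m (k ℕ.* m)))

  module _ (F : Carrier → Carrier)
           (F-cong : ∀ {a b} → a ≈ b → F a ≈ F b)
           (F-* : ∀ a b → F (a * b) ≈ F a * F b) (F-1 : F 1# ≈ 1#) where

    pow-homo : ∀ a k → F (pow R a k) ≈ pow R (F a) k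
    pow-homo a zero    = F-1
    pow-homo a (suc k) = trans (F-* a _) (*-congˡ (pow-homo a k))

  module _ (F : Carrier → Carrier)
           (F-cong : ∀ {a b} → a ≈ b → F a ≈ F b)
           (F-+ : ∀ a b → F (a + b) ≈ F a + F b) (F-0 : F 0# ≈ 0#) where

    ringSum-map-homo : ∀ {A : Set} (l : List A) {f g : A → Carrier} →
                       (∀ a → g a ≈ F (f a)) → ringSum R (map g l) ≈ F (ringSum R (map f l))
    ringSum-map-homo []      g≈Ff = sym F-0
    ringSum-map-homo (a ∷ l) g≈Ff = trans (+-cong (g≈Ff a) (ringSum-map-homo l g≈Ff)) (sym (F-+ _ _))

    σ-homo : ∀ {n d} ζ (x : Vecₙ n d) (dec : ∀ z → Dec (InOrbit x z)) {y y′ : Vecₙ n d} →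
             (∀ z → InOrbit x z → pow R ζ (dot z y′) ≈ F (pow R ζ (dot z y))) →
             σ R ζ x dec y′ ≈ F (σ R ζ x dec y)
    σ-homo {n} {d} ζ x dec {y} {y′} χ′≈Fχ = ringSum-map-homo (allVecs n d) term
      where
      term : ∀ z → (if does (dec z) then pow R ζ (dot z y′) else 0#)
                   ≈ F (if does (dec z) then pow R ζ (dot z y) else 0#)
      term z with dec z
      ... | yes z∈X = χ′≈Fχ z z∈X
      ... | no  _   = sym F-0

  module _ (ζ : Carrier) {n : ℕ} .{{_ : NonZero n}} (ζⁿ≈1 : pow R ζ n ≈ 1#) where

    pow-multiple : ∀ k → pow R ζ (k ℕ.* n) ≈ 1#
    pow-multiple zero    = refl
    pow-multiple (suc k) = begin
      pow R ζ (n ℕ.+ k ℕ.* n)         ≈⟨ pow-+ ζ n (k ℕ.* n) ⟩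
      pow R ζ n * pow R ζ (k ℕ.* n)   ≈⟨ *-cong ζⁿ≈1 (pow-multiple k) ⟩
      1# * 1#                         ≈⟨ *-identityˡ 1# ⟩
      1#                              ∎

    pow-% : ∀ a → pow R ζ (a % n) ≈ pow R ζ a
    pow-% a = begin
      pow R ζ (a % n)                              ≈⟨ *-identityʳ _ ⟨
      pow R ζ (a % n) * 1#                         ≈⟨ *-congˡ (pow-multiple (a / n)) ⟨
      pow R ζ (a % n) * pow R ζ (a / n ℕ.* n)      ≈⟨ pow-+ ζ (a % n) (a / n ℕ.* n) ⟨
      pow R ζ (a % n ℕ.+ a / n ℕ.* n)              ≡⟨ ≡.cong (pow R ζ) (m≡m%n+[m/n]*n a n) ⟨
      pow R ζ a                                    ∎

    pow-cong-mod : ∀ {a b} → a % n ≡ b % n → pow R ζ a ≈ pow R ζ b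
    pow-cong-mod {a} {b} a≡b = begin
      pow R ζ a        ≈⟨ pow-% a ⟨
      pow R ζ (a % n)  ≡⟨ ≡.cong (pow R ζ) a≡b ⟩
      pow R ζ (b % n)  ≈⟨ pow-% b ⟩
      pow R ζ b        ∎

    pow-dot-affine : ∀ {d} a b (z y : Vecₙ n d) →
                     pow R ζ (dot z (affine a b y)) ≈ pow R ζ (a ℕ.* dot z y ℕ.+ b ℕ.* coordSum z)
    pow-dot-affine a b z y = pow-cong-mod (dot-affine a b z y)

    module _ {d : ℕ} (x : Vecₙ n d) (dec : ∀ z → Dec (InOrbit x z)) where

      σ-translate : ∀ k y →
                    σ R ζ x dec (affine 1 k y) ≈ pow R ζ (k ℕ.* coordSum x) * σ R ζ x dec y
      σ-translate k y =
        σ-homo (pow R ζ (k ℕ.* coordSum x) *_) *-congˡ (distribˡ _) (zeroʳ _) ζ x dec χ-translate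
        where
        χ-translate : ∀ z → InOrbit x z →
                      pow R ζ (dot z (affine 1 k y)) ≈ pow R ζ (k ℕ.* coordSum x) * pow R ζ (dot z y)
        χ-translate z z∈X = begin
          pow R ζ (dot z (affine 1 k y))
            ≈⟨ pow-dot-affine 1 k z y ⟩
          pow R ζ (1 ℕ.* dot z y ℕ.+ k ℕ.* coordSum z)
            ≈⟨ pow-+ ζ (1 ℕ.* dot z y) (k ℕ.* coordSum z) ⟩
          pow R ζ (1 ℕ.* dot z y) * pow R ζ (k ℕ.* coordSum z)
            ≈⟨ *-comm _ _ ⟩
          pow R ζ (k ℕ.* coordSum z) * pow R ζ (1 ℕ.* dot z y)
            ≡⟨ ≡.cong₂ (λ s t → pow R ζ (k ℕ.* s) * pow R ζ t)
                       (coordSum-orbit z∈X) (ℕ.*-identityˡ (dot z y)) ⟩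
          pow R ζ (k ℕ.* coordSum x) * pow R ζ (dot z y)
            ∎

      σ-translate-gcd : ∃ λ k → ∀ y →
                        σ R ζ x dec (affine 1 k y) ≈ pow R ζ (gcd n (coordSum x)) * σ R ζ x dec y
      σ-translate-gcd = let (k , k[X]≡gcd) = bezout-mod n (coordSum x) in
        k , λ y → trans (σ-translate k y)
                        (*-congʳ (pow-cong-mod {k ℕ.* coordSum x} {gcd n (coordSum x)} k[X]≡gcd))

      module _ (conj : Carrier → Carrier)
               (conj-cong : ∀ {a b} → a ≈ b → conj a ≈ conj b)
               (conj-+ : ∀ a b → conj (a + b) ≈ conj a + conj b)
               (conj-* : ∀ a b → conj (a * b) ≈ conj a * conj b)
               (conj-1 : conj 1# ≈ 1#) (conj-0 : conj 0# ≈ 0#)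
               (conj-ζ : conj ζ ≈ pow R ζ (n ∸ 1)) where

        σ-reflect : ∀ y → σ R ζ x dec (affine (n ∸ 1) 0 y) ≈ conj (σ R ζ x dec y)
        σ-reflect y = σ-homo conj conj-cong conj-+ conj-0 ζ x dec χ-reflect
          where
          χ-reflect : ∀ z → InOrbit x z →
                      pow R ζ (dot z (affine (n ∸ 1) 0 y)) ≈ conj (pow R ζ (dot z y))
          χ-reflect z _ = begin
            pow R ζ (dot z (affine (n ∸ 1) 0 y))          ≈⟨ pow-dot-affine (n ∸ 1) 0 z y ⟩
            pow R ζ ((n ∸ 1) ℕ.* dot z y ℕ.+ 0)
              ≡⟨ ≡.cong (pow R ζ) (≡.trans (ℕ.+-identityʳ _) (ℕ.*-comm (n ∸ 1) (dot z y))) ⟩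
            pow R ζ (dot z y ℕ.* (n ∸ 1))                 ≈⟨ pow-* ζ (n ∸ 1) (dot z y) ⟨
            pow R (pow R ζ (n ∸ 1)) (dot z y)             ≈⟨ pow-congˡ (dot z y) conj-ζ ⟨
            pow R (conj ζ) (dot z y)
              ≈⟨ pow-homo conj conj-cong conj-* conj-1 ζ (dot z y) ⟨
            conj (pow R ζ (dot z y))                      ∎

proposition2p1 : {c ℓ : Level} (R : CommutativeRing c ℓ)
    → let open CommutativeRing R in
      (ζ : Carrier) (conj : Carrier → Carrier)
    → (∀ {a b} → a ≈ b → conj a ≈ conj b)
    → (∀ a b → conj (a + b) ≈ conj a + conj b)
    → (∀ a b → conj (a * b) ≈ conj a * conj b)
    → conj 1# ≈ 1#
    → conj 0# ≈ 0#
    → (n d : ℕ) → 1 ≤ n → 1 ≤ d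
    → pow R ζ n ≈ 1#
    → conj ζ ≈ pow R ζ (n ∸ 1)
    → (x : Vecₙ n d) (dec : ∀ z → Dec (InOrbit x z))
    → (∀ y → ∃ λ y′ → σ R ζ x dec y′ ≈ pow R ζ (gcd n (coordSum x)) * σ R ζ x dec y)
      × (∀ y → ∃ λ y′ → σ R ζ x dec y′ ≈ conj (σ R ζ x dec y))
proposition2p1 R ζ conj conj-cong conj-+ conj-* conj-1 conj-0 n@(suc _) d _ _ ζⁿ≈1 conj-ζ x dec =
  let (k , translate) = σ-translate-gcd R ζ ζⁿ≈1 x dec in
    (λ y → affine 1 k y , translate y)
  , (λ y → affine (n ∸ 1) 0 y
         , σ-reflect R ζ ζⁿ≈1 x dec conj conj-cong conj-+ conj-* conj-1 conj-0 conj-ζ y)
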